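{- Let $p\in\{1,2,3,4\}$ and let $H$ be the Sylvester Hadamard matrix of order $2^p$. Let $k\in\{1,\dots,p-1\}$ and let $H_{k,p}$ be any $2^k\times 2^p$ matrix obtained from $H$ by removing $2^p-2^k$ of its rows. Then at least one column of $H_{k,p}$ has column sum equal to $0$.
   Context: The Sylvester Hadamard matrix of order $2^p$ is the Kronecker product of $p$ copies of $\begin{bmatrix}1&1\\1&-1\end{bmatrix}$. -}

module Defs where

open import Data.Nat using (ℕ; zero; suc; _^_)
open import Data.Fin using (Fin; zero; suc; quotient; remainder)
open import Data.Integer using (ℤ; +_; -[1+_]; _*_; _+_)

Mat : ℕ → ℕ → Set
Mat m n = Fin m → Fin n → ℤ

H₂ : Mat 2 2
H₂ (suc zero) (suc zero) = -[1+ 0 ]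
H₂ _ _ = + 1

-- Kronecker product (A ⊗ B), index (i₁,i₂) ↦ i₁ * n + i₂
kron : ∀ {m n} → Mat m m → Mat n n → Mat (m Data.Nat.* n) (m Data.Nat.* n)
kron {m} {n} A B i j = A (quotient n i) (quotient n j) * B (remainder {m} n i) (remainder {m} n j)

-- Sylvester Hadamard matrix of order 2^p: p-fold Kronecker power of H₂
-- (H 0 = [1], H (p+1) = H₂ ⊗ H p; note 2 ^ suc p = 2 * 2 ^ p definitionally)
sylvester : (p : ℕ) → Mat (2 ^ p) (2 ^ p)
sylvester zero _ _ = + 1
sylvester (suc p) = kron H₂ (sylvester p)

sumℤ : ∀ {n} → (Fin n → ℤ) → ℤ
sumℤ {zero} f = + 0
sumℤ {suc n} f = f zero + sumℤ (λ i → f (suc i))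

colSum : ∀ {m n} → Mat m n → Fin n → ℤ
colSum M j = sumℤ (λ i → M i j)

module Submission where

-- Let H be a Hadamard matrix of order M = N + 1 (entries ±1, pairwise
-- orthogonal rows) with a column of ones, and keep L = 2c distinct rows.
-- Write s_y for the column sums of the kept rows.  Parseval's identity
-- gives  ∑_y s_y² = L·M,  and the column of ones contributes s_y₀² = L².
-- Each s_y is a sum of an even number of signs, hence even; if no s_y
-- vanishes, then every other square is 4(1 + R_y) with R_y = 0 or R_y ≥ 3,
-- and such "gapped" numbers are closed under addition.  Hence
--   L·M = L² + 4(N + R)  with R = 0 or R ≥ 3,                    (★)
-- and whenever the numbers L, M rule out (★), some column sum is zero.
-- For the Sylvester matrices of order 2^p, p ≤ 4, and L = 2^k, k < p, they
-- do; already for (p, k) = (5, 4) they do not, which is why p ≤ 4.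

open import Defs
open import Data.Nat using (ℕ; _≤_; _<_; _^_)
open import Data.Fin using (Fin)
open import Data.Integer using (ℤ; +_)
open import Data.Product using (∃-syntax)
open import Relation.Binary.PropositionalEquality using (_≡_)

open import Data.Nat as ℕ using (zero; suc; s≤s; z≤n)
import Data.Nat.Properties as ℕₚ
open import Data.Fin as F using (zero; suc; combine; quotient; remainder; _↑ˡ_; _↑ʳ_; punchIn)
import Data.Fin.Properties as Fₚ
open import Data.Integer using (-[1+_]; _+_; _*_; _-_)
import Data.Integer.Properties as ℤₚ
open import Data.Integer.Solver using (module +-*-Solver)
open import Algebra.Properties.Semiring.Sum ℤₚ.+-*-semiring
  using (sum; sum-syntax; ∑-comm; ∑-distrib-+; *-distribˡ-sum; *-distribʳ-sum; sum-remove; sum-cong-≗)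
open import Data.Product using (_×_; _,_; proj₁; proj₂)
open import Data.Sum using (_⊎_; inj₁; inj₂)
open import Data.Empty using (⊥-elim)
open import Function using (_∘_)
open import Function.Definitions using (Injective)
open import Relation.Nullary using (Dec; yes; no)
open import Relation.Nullary.Decidable using (False; toWitnessFalse; _⊎-dec_)
open import Relation.Binary.Definitions using (tri<; tri≈; tri>)
open import Relation.Binary.PropositionalEquality
  using (_≢_; refl; sym; trans; cong; cong₂; subst; module ≡-Reasoning)

sumℤ≡∑ : ∀ {n} (f : Fin n → ℤ) → sumℤ f ≡ sum f
sumℤ≡∑ {zero} f = refl
sumℤ≡∑ {suc n} f = cong (_+_ (f zero)) (sumℤ≡∑ (f ∘ suc))

∑-const : ∀ n (c : ℤ) → ∑[ i < n ] c ≡ + n * c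
∑-const zero c = refl
∑-const (suc n) c = begin
  c + ∑[ i < n ] c      ≡⟨ cong₂ _+_ (sym (ℤₚ.*-identityˡ c)) (∑-const n c) ⟩
  + 1 * c + + n * c     ≡⟨ sym (ℤₚ.*-distribʳ-+ c (+ 1) (+ n)) ⟩
  + suc n * c           ∎
  where open ≡-Reasoning

∑-single : ∀ {n} (f : Fin n → ℤ) (i : Fin n) → (∀ j → j ≢ i → f j ≡ + 0) → sum f ≡ f i
∑-single {suc n} f i off = begin
  sum f                                ≡⟨ sum-remove {i = i} f ⟩
  f i + ∑[ j < n ] f (punchIn i j)     ≡⟨ cong (_+_ (f i)) (sum-cong-≗ λ j → off _ (Fₚ.punchInᵢ≢i i j)) ⟩
  f i + ∑[ j < n ] (+ 0)               ≡⟨ cong (_+_ (f i)) (trans (∑-const n (+ 0)) (ℤₚ.*-zeroʳ (+ n))) ⟩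
  f i + + 0                            ≡⟨ ℤₚ.+-identityʳ (f i) ⟩
  f i                                  ∎
  where open ≡-Reasoning

∑-*-∑ : ∀ {m n} (f : Fin m → ℤ) (g : Fin n → ℤ) →
        sum f * sum g ≡ ∑[ i < m ] ∑[ j < n ] (f i * g j)
∑-*-∑ f g = trans (*-distribʳ-sum (sum g) f) (sum-cong-≗ λ i → *-distribˡ-sum (f i) g)

∑-↑ : ∀ m {n} (f : Fin (m ℕ.+ n) → ℤ) →
      sum f ≡ ∑[ i < m ] f (i ↑ˡ n) + ∑[ j < n ] f (m ↑ʳ j)
∑-↑ zero f = sym (ℤₚ.+-identityˡ (sum f))
∑-↑ (suc m) f = trans (cong (_+_ (f zero)) (∑-↑ m (f ∘ suc))) (sym (ℤₚ.+-assoc (f zero) _ _))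

∑-combine : ∀ m {n} (f : Fin (m ℕ.* n) → ℤ) →
            sum f ≡ ∑[ i < m ] ∑[ j < n ] f (combine i j)
∑-combine zero f = refl
∑-combine (suc m) {n} f =
  trans (∑-↑ n f) (cong (_+_ (∑[ j < n ] f (combine {suc m} zero j))) (∑-combine m {n} (λ k → f (n ↑ʳ k))))

remQuot-injective : ∀ {m} n {a b : Fin (m ℕ.* n)} →
  quotient {m} n a ≡ quotient {m} n b → remainder {m} n a ≡ remainder {m} n b → a ≡ b
remQuot-injective {m} n {a} {b} q≡ r≡ = begin
  a                                               ≡⟨ sym (Fₚ.combine-remQuot {m} n a) ⟩
  combine (quotient {m} n a) (remainder {m} n a)  ≡⟨ cong₂ combine q≡ r≡ ⟩
  combine (quotient {m} n b) (remainder {m} n b)  ≡⟨ Fₚ.combine-remQuot {m} n b ⟩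
  b                                               ∎
  where open ≡-Reasoning

IsSign : ℤ → Set
IsSign x = x ≡ + 1 ⊎ x ≡ -[1+ 0 ]

sign-square : ∀ {x} → IsSign x → x * x ≡ + 1
sign-square (inj₁ refl) = refl
sign-square (inj₂ refl) = refl

sign-* : ∀ {x y} → IsSign x → IsSign y → IsSign (x * y)
sign-* (inj₁ refl) (inj₁ refl) = inj₁ refl
sign-* (inj₁ refl) (inj₂ refl) = inj₂ refl
sign-* (inj₂ refl) (inj₁ refl) = inj₂ refl
sign-* (inj₂ refl) (inj₂ refl) = inj₁ refl

inner : ∀ {M} → Mat M M → Fin M → Fin M → ℤ
inner {M} H a b = ∑[ y < M ] (H a y * H b y)

record IsHadamard {M : ℕ} (H : Mat M M) : Set where
  field
    entry-sign : ∀ a y → IsSign (H a y)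
    orthogonal : ∀ a b → a ≢ b → inner H a b ≡ + 0

  row-norm : ∀ a → inner H a a ≡ + M
  row-norm a = begin
    ∑[ y < M ] (H a y * H a y)  ≡⟨ sum-cong-≗ (λ y → sign-square (entry-sign a y)) ⟩
    ∑[ y < M ] (+ 1)            ≡⟨ ∑-const M (+ 1) ⟩
    + M * + 1                   ≡⟨ ℤₚ.*-identityʳ (+ M) ⟩
    + M                         ∎
    where open ≡-Reasoning

  parseval : ∀ {L} (sel : Fin L → Fin M) → Injective _≡_ _≡_ sel →
    ∑[ y < M ] (∑[ i < L ] H (sel i) y * ∑[ j < L ] H (sel j) y) ≡ + L * + M
  parseval {L} sel inj = begin
    ∑[ y < M ] (∑[ i < L ] H (sel i) y * ∑[ j < L ] H (sel j) y)
      ≡⟨ sum-cong-≗ (λ y → ∑-*-∑ (λ i → H (sel i) y) (λ j → H (sel j) y)) ⟩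
    ∑[ y < M ] ∑[ i < L ] ∑[ j < L ] (H (sel i) y * H (sel j) y)
      ≡⟨ ∑-comm (λ y i → ∑[ j < L ] (H (sel i) y * H (sel j) y)) ⟩
    ∑[ i < L ] ∑[ y < M ] ∑[ j < L ] (H (sel i) y * H (sel j) y)
      ≡⟨ sum-cong-≗ (λ i → ∑-comm (λ y j → H (sel i) y * H (sel j) y)) ⟩
    ∑[ i < L ] ∑[ j < L ] ∑[ y < M ] (H (sel i) y * H (sel j) y)
      ≡⟨ sum-cong-≗ (λ i → trans (∑-single _ i (λ j j≢i → orthogonal _ _ (j≢i ∘ inj ∘ sym)))
                                 (row-norm (sel i))) ⟩
    ∑[ i < L ] (+ M)
      ≡⟨ ∑-const L (+ M) ⟩
    + L * + M ∎
    where open ≡-Reasoning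

kron-combine : ∀ {m n} (A : Mat m m) (B : Mat n n) (a : Fin (m ℕ.* n)) c d →
  kron A B a (combine c d) ≡ A (quotient n a) c * B (remainder {m} n a) d
kron-combine {m} {n} A B a c d =
  cong₂ (λ c′ d′ → A (quotient n a) c′ * B (remainder {m} n a) d′)
        (cong proj₁ (Fₚ.remQuot-combine c d)) (cong proj₂ (Fₚ.remQuot-combine c d))

kron-inner : ∀ {m n} (A : Mat m m) (B : Mat n n) (a b : Fin (m ℕ.* n)) →
  inner (kron A B) a b
    ≡ inner A (quotient n a) (quotient n b) * inner B (remainder {m} n a) (remainder {m} n b)
kron-inner {m} {n} A B a b = begin
  ∑[ y < m ℕ.* n ] (kron A B a y * kron A B b y)
    ≡⟨ ∑-combine m (λ y → kron A B a y * kron A B b y) ⟩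
  ∑[ c < m ] ∑[ d < n ] (kron A B a (combine c d) * kron A B b (combine c d))
    ≡⟨ sum-cong-≗ (λ c → sum-cong-≗ λ d →
         trans (cong₂ _*_ (kron-combine A B a c d) (kron-combine A B b c d))
               (regroup (A a₁ c) (B a₂ d) (A b₁ c) (B b₂ d))) ⟩
  ∑[ c < m ] ∑[ d < n ] ((A a₁ c * A b₁ c) * (B a₂ d * B b₂ d))
    ≡⟨ sym (∑-*-∑ (λ c → A a₁ c * A b₁ c) (λ d → B a₂ d * B b₂ d)) ⟩
  ∑[ c < m ] (A a₁ c * A b₁ c) * ∑[ d < n ] (B a₂ d * B b₂ d) ∎
  where
  open ≡-Reasoning
  a₁ = quotient n a
  b₁ = quotient n b
  a₂ = remainder {m} n a
  b₂ = remainder {m} n b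
  regroup : ∀ w x y z → (w * x) * (y * z) ≡ (w * y) * (x * z)
  regroup = solve 4 (λ w x y z → (w :* x) :* (y :* z) := (w :* y) :* (x :* z)) refl
    where open +-*-Solver

kron-hadamard : ∀ {m n} {A : Mat m m} {B : Mat n n} →
  IsHadamard A → IsHadamard B → IsHadamard (kron A B)
kron-hadamard {m} {n} {A} {B} hA hB = record
  { entry-sign = λ a y → sign-* (IsHadamard.entry-sign hA _ _) (IsHadamard.entry-sign hB _ _)
  ; orthogonal = orthogonal
  }
  where
  -- rows with different quotients are orthogonal in A; equal quotients force
  -- different remainders, orthogonal in B
  orthogonal : ∀ a b → a ≢ b → inner (kron A B) a b ≡ + 0
  orthogonal a b a≢b with quotient n a Fₚ.≟ quotient n b
  ... | no q≢ = trans (kron-inner A B a b)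
                      (cong (_* inner B _ _) (IsHadamard.orthogonal hA _ _ q≢))
  ... | yes q≡ = begin
    inner (kron A B) a b                             ≡⟨ kron-inner A B a b ⟩
    inner A _ _ * inner B _ _                        ≡⟨ cong (inner A (quotient n a) (quotient n b) *_) r-orth ⟩
    inner A (quotient n a) (quotient n b) * + 0      ≡⟨ ℤₚ.*-zeroʳ (inner A (quotient n a) (quotient n b)) ⟩
    + 0                                              ∎
    where
    open ≡-Reasoning
    r-orth : inner B (remainder {m} n a) (remainder {m} n b) ≡ + 0
    r-orth = IsHadamard.orthogonal hB _ _ (a≢b ∘ remQuot-injective {m} n q≡)

H₂-hadamard : IsHadamard H₂
H₂-hadamard = record { entry-sign = entry-sign ; orthogonal = orthogonal }
  where
  entry-sign : ∀ a y → IsSign (H₂ a y)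
  entry-sign zero zero = inj₁ refl
  entry-sign zero (suc zero) = inj₁ refl
  entry-sign (suc zero) zero = inj₁ refl
  entry-sign (suc zero) (suc zero) = inj₂ refl
  orthogonal : ∀ a b → a ≢ b → inner H₂ a b ≡ + 0
  orthogonal zero zero a≢b = ⊥-elim (a≢b refl)
  orthogonal zero (suc zero) _ = refl
  orthogonal (suc zero) zero _ = refl
  orthogonal (suc zero) (suc zero) a≢b = ⊥-elim (a≢b refl)

sylvester-hadamard : ∀ p → IsHadamard (sylvester p)
sylvester-hadamard zero = record { entry-sign = λ _ _ → inj₁ refl ; orthogonal = orthogonal }
  where
  orthogonal : ∀ a b → a ≢ b → inner (sylvester 0) a b ≡ + 0
  orthogonal zero zero a≢b = ⊥-elim (a≢b refl)
sylvester-hadamard (suc p) = kron-hadamard H₂-hadamard (sylvester-hadamard p)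

HasOnesColumn : ∀ {M} → Mat M M → Set
HasOnesColumn {M} H = ∃[ y₀ ] ∀ a → H a y₀ ≡ + 1

sylvester-ones-column : ∀ p → HasOnesColumn (sylvester p)
sylvester-ones-column zero = zero , λ _ → refl
sylvester-ones-column (suc p) with sylvester-ones-column p
... | y₀ , ones = combine {2} zero y₀ , λ a →
  trans (kron-combine H₂ (sylvester p) a zero y₀)
        (cong₂ _*_ (H₂-first-column (quotient (2 ^ p) a)) (ones (remainder {2} (2 ^ p) a)))
  where
  H₂-first-column : ∀ x → H₂ x zero ≡ + 1
  H₂-first-column zero = refl
  H₂-first-column (suc zero) = refl

-- A sum of an even number of signs is even: shifting each sign by 1 gives 0 or 2.
even-sign-sum : ∀ c (f : Fin (c ℕ.+ c) → ℤ) → (∀ i → IsSign (f i)) → ∃[ m ] sum f ≡ m + m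
even-sign-sum c f signs = E - + c , (begin
  sum f                                  ≡⟨ shift-back (sum f) (+ c + + c) ⟩
  (sum f + (+ c + + c)) - (+ c + + c)    ≡⟨ cong (λ t → (sum f + t) - (+ c + + c)) (sym (ℤₚ.pos-+ c c)) ⟩
  (sum f + + (c ℕ.+ c)) - (+ c + + c)    ≡⟨ cong (_- (+ c + + c)) shifted ⟩
  (E + E) - (+ c + + c)                  ≡⟨ halve E (+ c) ⟩
  (E - + c) + (E - + c)                  ∎)
  where
  open ≡-Reasoning
  open +-*-Solver
  half : ∀ {x} → IsSign x → ∃[ e ] x + + 1 ≡ e + e
  half (inj₁ refl) = + 1 , refl
  half (inj₂ refl) = + 0 , refl
  e : Fin (c ℕ.+ c) → ℤ
  e i = proj₁ (half (signs i))
  E = sum e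
  shifted : sum f + + (c ℕ.+ c) ≡ E + E
  shifted = begin
    sum f + + (c ℕ.+ c)               ≡⟨ cong (_+_ (sum f)) (sym (trans (∑-const (c ℕ.+ c) (+ 1)) (ℤₚ.*-identityʳ _))) ⟩
    sum f + ∑[ i < c ℕ.+ c ] (+ 1)    ≡⟨ sym (∑-distrib-+ f (λ _ → + 1)) ⟩
    ∑[ i < c ℕ.+ c ] (f i + + 1)      ≡⟨ sum-cong-≗ (λ i → proj₂ (half (signs i))) ⟩
    ∑[ i < c ℕ.+ c ] (e i + e i)      ≡⟨ ∑-distrib-+ e e ⟩
    E + E                             ∎
  shift-back : ∀ s t → s ≡ (s + t) - t
  shift-back = solve 2 (λ s t → s := (s :+ t) :- t) refl
  halve : ∀ x t → (x + x) - (t + t) ≡ (x - t) + (x - t)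
  halve = solve 2 (λ x t → (x :+ x) :- (t :+ t) := (x :- t) :+ (x :- t)) refl

-- The natural numbers 0, 3, 4, 5, ...: the possible values of (k+1)² - 1.
Gapped : ℕ → Set
Gapped R = R ≡ 0 ⊎ 3 ≤ R

gapped-+ : ∀ {R R′} → Gapped R → Gapped R′ → Gapped (R ℕ.+ R′)
gapped-+ (inj₁ refl) g = g
gapped-+ {R} (inj₂ 3≤R) (inj₁ refl) = inj₂ (subst (3 ≤_) (sym (ℕₚ.+-identityʳ R)) 3≤R)
gapped-+ {R} {R′} (inj₂ 3≤R) (inj₂ _) = inj₂ (ℕₚ.≤-trans 3≤R (ℕₚ.m≤m+n R R′))

nonzero-square : ∀ m → m ≢ + 0 → ∃[ R ] Gapped R × m * m ≡ + 1 + + R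
nonzero-square (+ zero) m≢0 = ⊥-elim (m≢0 refl)
nonzero-square (+ suc k) _ = _ , square-gap k , refl
  where
  square-gap : ∀ k → Gapped (k ℕ.+ k ℕ.* suc k)
  square-gap zero = inj₁ refl
  square-gap (suc k) = inj₂ (s≤s (ℕₚ.≤-trans (s≤s (s≤s z≤n)) (ℕₚ.m≤n+m _ k)))
nonzero-square -[1+ k ] _ = nonzero-square (+ suc k) (λ ())

even-square : ∀ m → m + m ≢ + 0 → ∃[ R ] Gapped R × (m + m) * (m + m) ≡ + 4 * (+ 1 + + R)
even-square m 2m≢0 with nonzero-square m (λ m≡0 → 2m≢0 (cong (λ t → t + t) m≡0))
... | R , gap , m²≡ = R , gap , trans (quadruple m) (cong (+ 4 *_) m²≡)
  where
  quadruple : ∀ m → (m + m) * (m + m) ≡ + 4 * (m * m)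
  quadruple = solve 1 (λ m → (m :+ m) :* (m :+ m) := con (+ 4) :* (m :* m)) refl
    where open +-*-Solver

∑-gapped : ∀ {N} (f : Fin N → ℤ) → (∀ y → ∃[ R ] Gapped R × f y ≡ + 4 * (+ 1 + + R)) →
  ∃[ R ] Gapped R × sum f ≡ + 4 * (+ N + + R)
∑-gapped {zero} f _ = 0 , inj₁ refl , refl
∑-gapped {suc N} f sq with sq zero | ∑-gapped (f ∘ suc) (sq ∘ suc)
... | R₀ , g₀ , f₀≡ | R , g , rest≡ = R₀ ℕ.+ R , gapped-+ g₀ g , (begin
  f zero + sum (f ∘ suc)                       ≡⟨ cong₂ _+_ f₀≡ rest≡ ⟩
  + 4 * (+ 1 + + R₀) + + 4 * (+ N + + R)       ≡⟨ regroup (+ N) (+ R₀) (+ R) ⟩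
  + 4 * (+ suc N + (+ R₀ + + R))               ≡⟨ cong (λ t → + 4 * (+ suc N + t)) (sym (ℤₚ.pos-+ R₀ R)) ⟩
  + 4 * (+ suc N + + (R₀ ℕ.+ R))               ∎)
  where
  open ≡-Reasoning
  regroup : ∀ n r₀ r → + 4 * (+ 1 + r₀) + + 4 * (n + r) ≡ + 4 * ((+ 1 + n) + (r₀ + r))
  regroup = solve 3 (λ n r₀ r → con (+ 4) :* (con (+ 1) :+ r₀) :+ con (+ 4) :* (n :+ r)
                            := con (+ 4) :* ((con (+ 1) :+ n) :+ (r₀ :+ r))) refl
    where open +-*-Solver

-- The two values of L·(N+1) allowed by the counting argument: (★) with R = 0 or R ≥ 3.
Admissible : ℕ → ℕ → Set
Admissible L N = L ℕ.* suc N ≡ L ℕ.* L ℕ.+ 4 ℕ.* N ⊎ L ℕ.* L ℕ.+ 4 ℕ.* (N ℕ.+ 3) ≤ L ℕ.* suc N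

admissible? : ∀ L N → Dec (Admissible L N)
admissible? L N = (L ℕ.* suc N ℕ.≟ L ℕ.* L ℕ.+ 4 ℕ.* N) ⊎-dec (L ℕ.* L ℕ.+ 4 ℕ.* (N ℕ.+ 3) ℕ.≤? L ℕ.* suc N)

excess-ℕ : ∀ L N R → + L * + suc N ≡ + L * + L + + 4 * (+ N + + R) →
  L ℕ.* suc N ≡ L ℕ.* L ℕ.+ 4 ℕ.* (N ℕ.+ R)
excess-ℕ L N R eqℤ = ℤₚ.+-injective (begin
  + (L ℕ.* suc N)                        ≡⟨ ℤₚ.pos-* L (suc N) ⟩
  + L * + suc N                          ≡⟨ eqℤ ⟩
  + L * + L + + 4 * (+ N + + R)          ≡⟨ cong₂ _+_ (sym (ℤₚ.pos-* L L)) four-times ⟩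
  + (L ℕ.* L) + + (4 ℕ.* (N ℕ.+ R))      ≡⟨ sym (ℤₚ.pos-+ (L ℕ.* L) _) ⟩
  + (L ℕ.* L ℕ.+ 4 ℕ.* (N ℕ.+ R))        ∎)
  where
  open ≡-Reasoning
  four-times : + 4 * (+ N + + R) ≡ + (4 ℕ.* (N ℕ.+ R))
  four-times = trans (cong (+ 4 *_) (sym (ℤₚ.pos-+ N R))) (sym (ℤₚ.pos-* 4 (N ℕ.+ R)))

gapped⇒admissible : ∀ {L N R} → Gapped R → L ℕ.* suc N ≡ L ℕ.* L ℕ.+ 4 ℕ.* (N ℕ.+ R) →
  Admissible L N
gapped⇒admissible {L} {N} (inj₁ refl) eq =
  inj₁ (trans eq (cong (λ t → L ℕ.* L ℕ.+ 4 ℕ.* t) (ℕₚ.+-identityʳ N)))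
gapped⇒admissible {L} {N} (inj₂ 3≤R) eq =
  inj₂ (subst (L ℕ.* L ℕ.+ 4 ℕ.* (N ℕ.+ 3) ≤_) (sym eq)
              (ℕₚ.+-monoʳ-≤ (L ℕ.* L) (ℕₚ.*-monoʳ-≤ 4 (ℕₚ.+-monoʳ-≤ N 3≤R))))

increasing⇒injective : ∀ {L M} (sel : Fin L → Fin M) →
  (∀ i j → i F.< j → sel i F.< sel j) → Injective _≡_ _≡_ sel
increasing⇒injective sel increasing {i} {j} sel-i≡sel-j with Fₚ.<-cmp i j
... | tri< i<j _ _ = ⊥-elim (Fₚ.<-irrefl sel-i≡sel-j (increasing i j i<j))
... | tri≈ _ i≡j _ = i≡j
... | tri> _ _ j<i = ⊥-elim (Fₚ.<-irrefl (sym sel-i≡sel-j) (increasing j i j<i))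

nonvanishing⇒admissible : ∀ {N} c {H : Mat (suc N) (suc N)} → IsHadamard H → HasOnesColumn H →
  (sel : Fin (c ℕ.+ c) → Fin (suc N)) → Injective _≡_ _≡_ sel →
  (∀ y → ∑[ i < c ℕ.+ c ] H (sel i) y ≢ + 0) → Admissible (c ℕ.+ c) N
nonvanishing⇒admissible {N} c {H} hadamard (y₀ , ones) sel injective nonzero =
  gapped⇒admissible {L} {N} gap (excess-ℕ L N R total)
  where
  open IsHadamard hadamard
  open ≡-Reasoning
  L = c ℕ.+ c
  s : Fin (suc N) → ℤ
  s y = ∑[ i < L ] H (sel i) y
  s-ones : s y₀ ≡ + L
  s-ones = trans (sum-cong-≗ (λ i → ones (sel i))) (trans (∑-const L (+ 1)) (ℤₚ.*-identityʳ (+ L)))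
  -- every column sum is even and nonzero, so its square is 4(1 + R) with R gapped
  column-square : ∀ y → ∃[ R ] Gapped R × s y * s y ≡ + 4 * (+ 1 + + R)
  column-square y with even-sign-sum c (λ i → H (sel i) y) (λ i → entry-sign (sel i) y)
  ... | m , s≡2m with even-square m (nonzero y ∘ trans s≡2m)
  ...   | R , gap , square = R , gap , trans (cong₂ _*_ s≡2m s≡2m) square
  others : ∃[ R ] Gapped R × ∑[ j < N ] (s (punchIn y₀ j) * s (punchIn y₀ j)) ≡ + 4 * (+ N + + R)
  others = ∑-gapped (λ j → s (punchIn y₀ j) * s (punchIn y₀ j)) (column-square ∘ punchIn y₀)
  R = proj₁ others
  gap = proj₁ (proj₂ others)
  total : + L * + suc N ≡ + L * + L + + 4 * (+ N + + R)
  total = begin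
    + L * + suc N
      ≡⟨ sym (parseval sel injective) ⟩
    ∑[ y < suc N ] (s y * s y)
      ≡⟨ sum-remove {i = y₀} (λ y → s y * s y) ⟩
    s y₀ * s y₀ + ∑[ j < N ] (s (punchIn y₀ j) * s (punchIn y₀ j))
      ≡⟨ cong₂ _+_ (cong₂ _*_ s-ones s-ones) (proj₂ (proj₂ others)) ⟩
    + L * + L + + 4 * (+ N + + R) ∎

zero-column-sum : ∀ {N} c {H : Mat (suc N) (suc N)} → IsHadamard H → HasOnesColumn H →
  (sel : Fin (c ℕ.+ c) → Fin (suc N)) → (∀ i j → i F.< j → sel i F.< sel j) →
  {excluded : False (admissible? (c ℕ.+ c) N)} →
  ∃[ y ] colSum (λ i x → H (sel i) x) y ≡ + 0
zero-column-sum c {H} hadamard ones sel increasing {excluded}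
  with Fₚ.any? (λ y → colSum (λ i x → H (sel i) x) y ℤₚ.≟ + 0)
... | yes vanishing = vanishing
... | no none = ⊥-elim (toWitnessFalse excluded
  (nonvanishing⇒admissible c hadamard ones sel (increasing⇒injective sel increasing)
    (λ y s≡0 → none (y , trans (sumℤ≡∑ (λ i → H (sel i) y)) s≡0))))

-- The theorem: Sylvester matrices are Hadamard with a column of ones, and in
-- each of the six cases (p, k) the sizes L = 2^k, N + 1 = 2^p are not admissible
-- (decided by evaluation through the implicit argument of zero-column-sum).
lemma1 : (p k : ℕ) → 1 ≤ p → p ≤ 4 → 1 ≤ k → k < p →
         (sel : Fin (2 ^ k) → Fin (2 ^ p)) →
         (∀ i j → i Data.Fin.< j → sel i Data.Fin.< sel j) →
         ∃[ j ] colSum (λ i c → sylvester p (sel i) c) j ≡ + 0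
lemma1 2 1 _ _ _ _ sel increasing =
  zero-column-sum 1 (sylvester-hadamard 2) (sylvester-ones-column 2) sel increasing
lemma1 3 1 _ _ _ _ sel increasing =
  zero-column-sum 1 (sylvester-hadamard 3) (sylvester-ones-column 3) sel increasing
lemma1 3 2 _ _ _ _ sel increasing =
  zero-column-sum 2 (sylvester-hadamard 3) (sylvester-ones-column 3) sel increasing
lemma1 4 1 _ _ _ _ sel increasing =
  zero-column-sum 1 (sylvester-hadamard 4) (sylvester-ones-column 4) sel increasing
lemma1 4 2 _ _ _ _ sel increasing =
  zero-column-sum 2 (sylvester-hadamard 4) (sylvester-ones-column 4) sel increasing
lemma1 4 3 _ _ _ _ sel increasing =
  zero-column-sum 4 (sylvester-hadamard 4) (sylvester-ones-column 4) sel increasing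
lemma1 zero _ () _ _ _ _ _
lemma1 _ zero _ _ () _ _ _
lemma1 1 (suc k) _ _ _ (s≤s ()) _ _
lemma1 2 (suc (suc k)) _ _ _ (s≤s (s≤s ())) _ _
lemma1 3 (suc (suc (suc k))) _ _ _ (s≤s (s≤s (s≤s ()))) _ _
lemma1 4 (suc (suc (suc (suc k)))) _ _ _ (s≤s (s≤s (s≤s (s≤s ())))) _ _
lemma1 (suc (suc (suc (suc (suc _))))) _ _ (s≤s (s≤s (s≤s (s≤s ())))) _ _ _ _
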